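{- For an ordinal $\alpha$ of finite degree, let $\mathrm{I}(\alpha)=\{\beta:\beta\text{ an ordinal of finite degree},\ \mathrm{D}(\beta)=\alpha\}$. When restricted to the set of limit ordinals $\alpha$ of finite degree, $\mathrm{I}$ defines a function (i.e. $\mathrm{I}(\alpha)$ consists of exactly one ordinal), and this function is the inverse of $\mathrm{D}$.
   Context: For a linear order $L$, $x\sim_F y$ iff only finitely many points lie between $x$ and $y$; $L/\!\sim_F$ is the ordered set of equivalence classes. For an ordinal $\alpha$, $\mathrm{D}(\alpha)$ is the ordinal isomorphic to $\alpha/\!\sim_F$. Ordinals of finite degree are those whose Cantor normal form is $a_n\omega^n+\cdots+a_1\omega+a_0$ with $n<\omega$ (products lexicographic, so $a\omega^k$ is $a$ copies of $\omega^k$). -}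

module Defs where

open import Data.Nat using (ℕ; zero; suc; _<_)
open import Data.List using (List; []; _∷_; length)
open import Data.List.Membership.Propositional using (_∈_)
open import Data.Product using (Σ; ∃; _×_; _,_)
open import Data.Sum using (_⊎_)
open import Data.Unit using (⊤)
open import Relation.Binary.PropositionalEquality using (_≡_; _≢_)
open import Function.Bundles using (_⇔_)

-- Ordinals of finite degree (i.e. < ω^ω) in Cantor normal form.
-- The list [a_n , … , a_1 , a_0] (big-endian) denotes
--   a_n ω^n + ⋯ + a_1 ω + a_0 ;  the empty list denotes 0.
CNF : Set
CNF = List ℕ

-- Normal form: leading coefficient nonzero (so representation is unique).
Normal : CNF → Set
Normal []      = ⊤
Normal (a ∷ _) = a ≢ 0

-- Lexicographic strict order on lists (used on lists of equal length).
data _<Lex_ : CNF → CNF → Set where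
  here  : ∀ {x y xs ys} → x < y → (x ∷ xs) <Lex (y ∷ ys)
  there : ∀ {x xs ys} → xs <Lex ys → (x ∷ xs) <Lex (x ∷ ys)

_<ᴼ_ : CNF → CNF → Set
xs <ᴼ ys = length xs < length ys ⊎ (length xs ≡ length ys × xs <Lex ys)

_≤ᴼ_ : CNF → CNF → Set
xs ≤ᴼ ys = xs <ᴼ ys ⊎ xs ≡ ys

-- The ordinal β viewed as a linear order: its elements are the ordinals γ < β.
Elem : CNF → CNF → Set
Elem β γ = Normal γ × γ <ᴼ β

Between : CNF → CNF → CNF → Set
Between x z y = (x <ᴼ z × z <ᴼ y) ⊎ (y <ᴼ z × z <ᴼ x)

-- x ∼_F y in the linear order β: only finitely many points of β lie
-- between x and y (all of them occur in some finite list).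
FinEq : CNF → CNF → CNF → Set
FinEq β x y = ∃ λ (ℓ : List CNF) → ∀ z → Elem β z → Between x z y → z ∈ ℓ

-- D(β) = α :  β/∼_F is order-isomorphic to α.  Expressed by a map f from β
-- onto α whose fibres are exactly the ∼_F-classes and which is monotone;
-- the induced map β/∼_F → α is then an order isomorphism.
Condenses : CNF → CNF → Set
Condenses β α =
  Σ (CNF → CNF) λ f →
      (∀ x → Elem β x → Elem α (f x))
    × (∀ y → Elem α y → ∃ λ x → Elem β x × f x ≡ y)
    × (∀ x y → Elem β x → Elem β y → (FinEq β x y ⇔ (f x ≡ f y)))
    × (∀ x y → Elem β x → Elem β y → x <ᴼ y → f x ≤ᴼ f y)

Limit : CNF → Set
Limit α = α ≢ [] × (∀ γ → Elem α γ → ∃ λ δ → Elem α δ × γ <ᴼ δ)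

-- Write a normal form as γ = ω · quot γ + rem γ. Two points of β are ∼F-equivalent iff they
-- have the same quotient: the block ω · q + k (k < ω) is one class, and between points of
-- different blocks lie infinitely many ω · q + k. So ω · α condenses onto α, while ω · p + (m+1)
-- has a greatest element, hence so does every condensation of it, and a limit α has none.
-- Condensations are unique because two condensations of β give a strictly increasing map
-- from one image into the other, and a well-order admits no such map into a proper initial
-- segment.
module Submission where

open import Data.Empty using (⊥-elim)
open import Data.List using (List; []; _∷_; length; _∷ʳ_; initLast; _∷ʳ′_; map; applyUpTo)
open import Data.List.Extrema.Nat using (max; ⊥≤max; xs≤max)
open import Data.List.Membership.Propositional using (_∈_; _∉_)
open import Data.List.Membership.Propositional.Properties using (∈-map⁺; ∈-applyUpTo⁺)
open import Data.List.Properties using (length-++)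
import Data.List.Relation.Unary.All as All
open import Data.Nat using (ℕ; zero; suc; _+_; _<_; _≤_; z≤n; s≤s)
open import Data.Nat.Induction using (<-wellFounded)
open import Data.Nat.Properties
  using (<-irrefl; <-trans; <-cmp; suc-injective; +-comm; ≤-pred; ≤-refl; ≤⇒≯; <-≤-trans;
         m≤m+n; m≤n+m; 1+n≰n; n≮0; n≢0⇒n>0)
open import Data.Product using (Σ; ∃; _×_; _,_; proj₁; proj₂)
open import Data.Product.Relation.Binary.Lex.Strict using (×-Lex; ×-wellFounded)
open import Data.Sum using (_⊎_; inj₁; inj₂; [_,_]; map₁; map₂; swap)
open import Function.Base using (_on_; _∘_)
open import Function.Bundles using (_⇔_; mk⇔; Equivalence)
open import Induction.WellFounded using (WellFounded; Acc; acc; module Subrelation)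
import Relation.Binary.Construct.On as On
open import Relation.Binary.Definitions using (Tri; tri<; tri≈; tri>; Trichotomous)
open import Relation.Binary.PropositionalEquality using (_≡_; refl; sym; trans; cong; subst; subst₂)
open import Relation.Nullary using (¬_)

open import Defs

<Lex-irrefl : ∀ {xs} → ¬ xs <Lex xs
<Lex-irrefl (here x<x) = <-irrefl refl x<x
<Lex-irrefl (there p)  = <Lex-irrefl p

<Lex-trans : ∀ {xs ys zs} → xs <Lex ys → ys <Lex zs → xs <Lex zs
<Lex-trans (here p)  (here q)  = here (<-trans p q)
<Lex-trans (here p)  (there _) = here p
<Lex-trans (there _) (here q)  = here q
<Lex-trans (there p) (there q) = there (<Lex-trans p q)

<Lex-asym : ∀ {xs ys} → xs <Lex ys → ¬ ys <Lex xs
<Lex-asym p q = <Lex-irrefl (<Lex-trans p q)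

<Lex-compare : ∀ xs ys → length xs ≡ length ys → Tri (xs <Lex ys) (xs ≡ ys) (ys <Lex xs)
<Lex-compare []       []       _ = tri≈ <Lex-irrefl refl <Lex-irrefl
<Lex-compare (x ∷ xs) (y ∷ ys) e with <-cmp x y
... | tri< x<y _ _ = tri< (here x<y) (λ { refl → <-irrefl refl x<y }) (<Lex-asym (here x<y))
... | tri> _ _ y<x = tri> (<Lex-asym (here y<x)) (λ { refl → <-irrefl refl y<x }) (here y<x)
... | tri≈ _ refl _ with <Lex-compare xs ys (suc-injective e)
...   | tri< p _ _    = tri< (there p) (λ { refl → <Lex-irrefl p }) (<Lex-asym (there p))
...   | tri≈ _ refl _ = tri≈ <Lex-irrefl refl <Lex-irrefl
...   | tri> _ _ p    = tri> (<Lex-asym (there p)) (λ { refl → <Lex-irrefl p }) (there p)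

<ᴼ-irrefl : ∀ {xs} → ¬ xs <ᴼ xs
<ᴼ-irrefl (inj₁ l)       = <-irrefl refl l
<ᴼ-irrefl (inj₂ (_ , p)) = <Lex-irrefl p

<ᴼ-trans : ∀ {xs ys zs} → xs <ᴼ ys → ys <ᴼ zs → xs <ᴼ zs
<ᴼ-trans (inj₁ l)       (inj₁ m)        = inj₁ (<-trans l m)
<ᴼ-trans (inj₁ l)       (inj₂ (e , _))  = inj₁ (subst (_ <_) e l)
<ᴼ-trans (inj₂ (e , _)) (inj₁ m)        = inj₁ (subst (_< _) (sym e) m)
<ᴼ-trans (inj₂ (e , p)) (inj₂ (e′ , q)) = inj₂ (trans e e′ , <Lex-trans p q)

<ᴼ-asym : ∀ {xs ys} → xs <ᴼ ys → ¬ ys <ᴼ xs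
<ᴼ-asym p q = <ᴼ-irrefl (<ᴼ-trans p q)

<ᴼ-cmp : Trichotomous _≡_ _<ᴼ_
<ᴼ-cmp xs ys with <-cmp (length xs) (length ys)
... | tri< l _ _ = tri< (inj₁ l) (λ { refl → <-irrefl refl l }) (<ᴼ-asym (inj₁ l))
... | tri> _ _ l = tri> (<ᴼ-asym (inj₁ l)) (λ { refl → <-irrefl refl l }) (inj₁ l)
... | tri≈ _ e _ with <Lex-compare xs ys e
...   | tri< p _ _    = tri< (inj₂ (e , p)) (λ { refl → <Lex-irrefl p }) (<ᴼ-asym (inj₂ (e , p)))
...   | tri≈ _ refl _ = tri≈ <ᴼ-irrefl refl <ᴼ-irrefl
...   | tri> _ _ p    = tri> (<ᴼ-asym (inj₂ (sym e , p))) (λ { refl → <Lex-irrefl p }) (inj₂ (sym e , p))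

≮[] : ∀ {xs} → ¬ xs <ᴼ []
≮[] (inj₁ ())
≮[] (inj₂ (_ , ()))

≤ᴼ⇒≯ : ∀ {x y} → x ≤ᴼ y → ¬ y <ᴼ x
≤ᴼ⇒≯ (inj₁ x<y)  = <ᴼ-asym x<y
≤ᴼ⇒≯ (inj₂ refl) = <ᴼ-irrefl

_<ₗ_ : CNF → CNF → Set
xs <ₗ ys = length xs ≡ length ys × xs <Lex ys

<ₗ-wellFounded : WellFounded _<ₗ_
<ₗ-wellFounded xs = accessible (length xs) xs refl
  where
  accessible : ∀ n xs → length xs ≡ n → Acc _<ₗ_ xs
  accessible zero    []       _ = acc λ { (_ , ()) }
  accessible (suc n) (x ∷ xs) e =
    acc (below (<-wellFounded x) (accessible n xs (suc-injective e)) (suc-injective e))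
    where
    below : ∀ {x xs} → Acc _<_ x → Acc _<ₗ_ xs → length xs ≡ n → ∀ {zs} → zs <ₗ (x ∷ xs) → Acc _<ₗ_ zs
    below (acc rx) _ len {_ ∷ ys} (e′ , here y<x) = acc (below (rx y<x) (accessible n ys len′) len′)
      where len′ = trans (suc-injective e′) len
    below accx (acc rxs) len {_ ∷ ys} (e′ , there ys<xs) =
      acc (below accx (rxs (suc-injective e′ , ys<xs)) (trans (suc-injective e′) len))

<ᴼ-wellFounded : WellFounded _<ᴼ_
<ᴼ-wellFounded = Subrelation.wellFounded <ᴼ⇒lex
  (On.wellFounded (λ xs → length xs , xs) (×-wellFounded <-wellFounded <ₗ-wellFounded))
  where
  <ᴼ⇒lex : ∀ {xs ys} → xs <ᴼ ys → ×-Lex _≡_ _<_ _<ₗ_ (length xs , xs) (length ys , ys)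
  <ᴼ⇒lex (inj₁ l)       = inj₁ l
  <ᴼ⇒lex (inj₂ (e , p)) = inj₂ (e , e , p)

-- Division by ω on the left, γ = ω · quot γ + rem γ: drop, resp. read off, the coefficient of ω⁰.
quot : CNF → CNF
quot []           = []
quot (a ∷ [])     = []
quot (a ∷ b ∷ as) = a ∷ quot (b ∷ as)

rem : CNF → ℕ
rem []           = 0
rem (a ∷ [])     = a
rem (a ∷ b ∷ as) = rem (b ∷ as)

-- Normalising: ω · [] + 0 is [], not the non-normal [0].
infix 25 ω·_+_
ω·_+_ : CNF → ℕ → CNF
ω· []      + zero  = []
ω· []      + suc k = suc k ∷ []
ω· (a ∷ p) + k     = (a ∷ p) ∷ʳ k

quot-∷ʳ : ∀ p k → quot (p ∷ʳ k) ≡ p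
quot-∷ʳ []          k = refl
quot-∷ʳ (a ∷ [])    k = refl
quot-∷ʳ (a ∷ b ∷ p) k = cong (a ∷_) (quot-∷ʳ (b ∷ p) k)

rem-∷ʳ : ∀ p k → rem (p ∷ʳ k) ≡ k
rem-∷ʳ []          k = refl
rem-∷ʳ (a ∷ [])    k = refl
rem-∷ʳ (a ∷ b ∷ p) k = rem-∷ʳ (b ∷ p) k

quot-ω·+ : ∀ p k → quot (ω· p + k) ≡ p
quot-ω·+ []      zero    = refl
quot-ω·+ []      (suc k) = refl
quot-ω·+ (a ∷ p) k       = quot-∷ʳ (a ∷ p) k

rem-ω·+ : ∀ p k → rem (ω· p + k) ≡ k
rem-ω·+ []      zero    = refl
rem-ω·+ []      (suc k) = refl
rem-ω·+ (a ∷ p) k       = rem-∷ʳ (a ∷ p) k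

ω·+-normal : ∀ {p} k → Normal p → Normal (ω· p + k)
ω·+-normal {[]}    zero    _   = _
ω·+-normal {[]}    (suc k) _   = λ ()
ω·+-normal {a ∷ p} k       a≢0 = a≢0

quot-normal : ∀ {x} → Normal x → Normal (quot x)
quot-normal {[]}         _   = _
quot-normal {a ∷ []}     _   = _
quot-normal {a ∷ b ∷ as} a≢0 = a≢0

quot-∷ʳ-rem : ∀ a as → quot (a ∷ as) ∷ʳ rem (a ∷ as) ≡ a ∷ as
quot-∷ʳ-rem a []       = refl
quot-∷ʳ-rem a (b ∷ as) = cong (a ∷_) (quot-∷ʳ-rem b as)

ω·quot+rem : ∀ {x} → Normal x → ω· quot x + rem x ≡ x
ω·quot+rem {[]}           _   = refl
ω·quot+rem {zero ∷ []}    0≢0 = ⊥-elim (0≢0 refl)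
ω·quot+rem {suc a ∷ []}   _   = refl
ω·quot+rem {a ∷ b ∷ as}   _   = cong (a ∷_) (quot-∷ʳ-rem b as)

length-∷ʳ : ∀ (p : CNF) k → length (p ∷ʳ k) ≡ suc (length p)
length-∷ʳ p k = trans (length-++ p) (+-comm (length p) 1)

∷ʳ-<Lex⁻ : ∀ {p q k m} → length p ≡ length q →
           (p ∷ʳ k) <Lex (q ∷ʳ m) → ×-Lex _≡_ _<Lex_ _<_ (p , k) (q , m)
∷ʳ-<Lex⁻ {[]}    {[]}    _ (here k<m) = inj₂ (refl , k<m)
∷ʳ-<Lex⁻ {_ ∷ _} {_ ∷ _} _ (here a<b) = inj₁ (here a<b)
∷ʳ-<Lex⁻ {_ ∷ p} {_ ∷ q} e (there r) with ∷ʳ-<Lex⁻ {p} {q} (suc-injective e) r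
... | inj₁ p<q          = inj₁ (there p<q)
... | inj₂ (refl , k<m) = inj₂ (refl , k<m)

∷ʳ-<Lex⁺ : ∀ {p q k m} → ×-Lex _≡_ _<Lex_ _<_ (p , k) (q , m) → (p ∷ʳ k) <Lex (q ∷ʳ m)
∷ʳ-<Lex⁺                 (inj₁ (here a<b))  = here a<b
∷ʳ-<Lex⁺                 (inj₁ (there p<q)) = there (∷ʳ-<Lex⁺ (inj₁ p<q))
∷ʳ-<Lex⁺ {[]}            (inj₂ (refl , k<m)) = here k<m
∷ʳ-<Lex⁺ {a ∷ p} {k = k} (inj₂ (refl , k<m)) = there (∷ʳ-<Lex⁺ {p} {k = k} (inj₂ (refl , k<m)))

∷ʳ-<ᴼ⁻ : ∀ {p q k m} → (p ∷ʳ k) <ᴼ (q ∷ʳ m) → ×-Lex _≡_ _<ᴼ_ _<_ (p , k) (q , m)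
∷ʳ-<ᴼ⁻ {p} {q} {k} {m} (inj₁ l) = inj₁ (inj₁ (≤-pred (subst₂ _<_ (length-∷ʳ p k) (length-∷ʳ q m) l)))
∷ʳ-<ᴼ⁻ {p} {q} {k} {m} (inj₂ (e , r)) = map₁ (λ p<q → inj₂ (∣p∣≡∣q∣ , p<q)) (∷ʳ-<Lex⁻ ∣p∣≡∣q∣ r)
  where ∣p∣≡∣q∣ = suc-injective (trans (sym (length-∷ʳ p k)) (trans e (length-∷ʳ q m)))

∷ʳ-<ᴼ⁺ : ∀ {p q k m} → ×-Lex _≡_ _<ᴼ_ _<_ (p , k) (q , m) → (p ∷ʳ k) <ᴼ (q ∷ʳ m)
∷ʳ-<ᴼ⁺ {p} {q} {k} {m} (inj₁ (inj₁ l)) = inj₁ (subst₂ _<_ (sym (length-∷ʳ p k)) (sym (length-∷ʳ q m)) (s≤s l))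
∷ʳ-<ᴼ⁺ {p} {q} {k} {m} (inj₁ (inj₂ (e , r))) =
  inj₂ (trans (length-∷ʳ p k) (trans (cong suc e) (sym (length-∷ʳ q m))) , ∷ʳ-<Lex⁺ (inj₁ r))
∷ʳ-<ᴼ⁺ {p} {k = k} {m} (inj₂ (refl , k<m)) =
  inj₂ (trans (length-∷ʳ p k) (sym (length-∷ʳ p m)) , ∷ʳ-<Lex⁺ {p} (inj₂ (refl , k<m)))

_<÷_ : CNF → CNF → Set
_<÷_ = ×-Lex _≡_ _<ᴼ_ _<_ on λ x → quot x , rem x

<÷⇒<ᴼ : ∀ {x y} → x <÷ y → x <ᴼ y
<÷⇒<ᴼ {x} {y} r with initLast x | initLast y
<÷⇒<ᴼ (inj₁ r)        | []      | []      = ⊥-elim (<ᴼ-irrefl r)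
<÷⇒<ᴼ (inj₂ (_ , ())) | []      | []
<÷⇒<ᴼ _               | []      | q ∷ʳ′ m = inj₁ (subst (0 <_) (sym (length-∷ʳ q m)) (s≤s z≤n))
<÷⇒<ᴼ r               | p ∷ʳ′ k | []
  rewrite quot-∷ʳ p k | rem-∷ʳ p k = ⊥-elim ([ ≮[] , (λ { (_ , ()) }) ] r)
<÷⇒<ᴼ r               | p ∷ʳ′ k | q ∷ʳ′ m
  rewrite quot-∷ʳ p k | quot-∷ʳ q m | rem-∷ʳ p k | rem-∷ʳ q m = ∷ʳ-<ᴼ⁺ r

-- Normality of y is needed: [] <ᴼ [0], yet both have quotient [] and remainder 0.
<ᴼ⇒<÷ : ∀ {x y} → Normal y → x <ᴼ y → x <÷ y
<ᴼ⇒<÷ {x} {y} ny l with initLast x | initLast y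
<ᴼ⇒<÷ _  l | []      | []            = ⊥-elim (<ᴼ-irrefl l)
<ᴼ⇒<÷ _  l | p ∷ʳ′ k | []            = ⊥-elim (≮[] l)
<ᴼ⇒<÷ ny _ | []      | [] ∷ʳ′ m      = inj₂ (refl , n≢0⇒n>0 ny)
<ᴼ⇒<÷ _  _ | []      | (a ∷ q) ∷ʳ′ m rewrite quot-∷ʳ (a ∷ q) m = inj₁ (inj₁ (s≤s z≤n))
<ᴼ⇒<÷ _  l | p ∷ʳ′ k | q ∷ʳ′ m
  rewrite quot-∷ʳ p k | quot-∷ʳ q m | rem-∷ʳ p k | rem-∷ʳ q m = ∷ʳ-<ᴼ⁻ l

<÷-sandwich : ∀ {x y z} → quot x ≡ quot y → x <÷ z → z <÷ y →
              quot z ≡ quot x × rem x < rem z × rem z < rem y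
<÷-sandwich e (inj₁ p)         (inj₁ q)         = ⊥-elim (<ᴼ-irrefl (subst (_ <ᴼ_) (sym e) (<ᴼ-trans p q)))
<÷-sandwich e (inj₁ p)         (inj₂ (e′ , _))  = ⊥-elim (<ᴼ-irrefl (subst (_ <ᴼ_) (trans e′ (sym e)) p))
<÷-sandwich e (inj₂ (e′ , _))  (inj₁ q)         = ⊥-elim (<ᴼ-irrefl (subst (_<ᴼ _) (trans (sym e′) e) q))
<÷-sandwich e (inj₂ (e′ , r<)) (inj₂ (_ , r<′)) = sym e′ , r< , r<′

sameQuot⇒FinEq : ∀ β {x y} → Elem β x → Elem β y → quot x ≡ quot y → FinEq β x y
sameQuot⇒FinEq β {x} {y} (nx , _) (ny , _) q≡ = applyUpTo (λ k → ω· quot x + k) (rem x + rem y) , between∈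
  where
  block∈ : ∀ {z n} → Normal z → quot z ≡ quot x → rem z < n → z ∈ applyUpTo (λ k → ω· quot x + k) n
  block∈ {z} nz qz≡ r< = subst (_∈ _) z≡ (∈-applyUpTo⁺ (λ k → ω· quot x + k) r<)
    where
    z≡ : ω· quot x + rem z ≡ z
    z≡ = trans (cong (λ q → ω· q + rem z) (sym qz≡)) (ω·quot+rem nz)
  between∈ : ∀ z → Elem β z → Between x z y → z ∈ applyUpTo (λ k → ω· quot x + k) (rem x + rem y)
  between∈ z (nz , _) (inj₁ (x<z , z<y)) with <÷-sandwich q≡ (<ᴼ⇒<÷ nz x<z) (<ᴼ⇒<÷ ny z<y)
  ... | qz≡ , _ , r< = block∈ nz qz≡ (<-≤-trans r< (m≤n+m (rem y) (rem x)))
  between∈ z (nz , _) (inj₂ (y<z , z<x)) with <÷-sandwich (sym q≡) (<ᴼ⇒<÷ nz y<z) (<ᴼ⇒<÷ nx z<x)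
  ... | qz≡ , _ , r< = block∈ nz (trans qz≡ (sym q≡)) (<-≤-trans r< (m≤m+n (rem x) (rem y)))

quot<⇒infinitelyBetween : ∀ {β x y} → Normal x → Elem β y → quot x <ᴼ quot y →
                          (ℓ : List CNF) → ∃ λ z → Elem β z × x <ᴼ z × z <ᴼ y × z ∉ ℓ
quot<⇒infinitelyBetween {β} {x} {y} nx (_ , y<β) q< ℓ =
  z , (ω·+-normal K (quot-normal nx) , <ᴼ-trans z<y y<β) , x<z , z<y , z∉ℓ
  where
  K = suc (max (rem x) (map rem ℓ))
  z = ω· quot x + K
  x<z : x <ᴼ z
  x<z = <÷⇒<ᴼ (inj₂ (sym (quot-ω·+ (quot x) K) ,
                      subst (rem x <_) (sym (rem-ω·+ (quot x) K)) (s≤s (⊥≤max (rem x) (map rem ℓ)))))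
  z<y : z <ᴼ y
  z<y = <÷⇒<ᴼ (inj₁ (subst (_<ᴼ quot y) (sym (quot-ω·+ (quot x) K)) q<))
  z∉ℓ : z ∉ ℓ
  z∉ℓ z∈ℓ = 1+n≰n (subst (_≤ max (rem x) (map rem ℓ)) (rem-ω·+ (quot x) K)
                         (All.lookup (xs≤max (rem x) (map rem ℓ)) (∈-map⁺ rem z∈ℓ)))

quot<⇒¬FinEq : ∀ {β x y} → Elem β x → Elem β y → quot x <ᴼ quot y → ¬ FinEq β x y
quot<⇒¬FinEq (nx , _) y∈β q< (ℓ , finite) with quot<⇒infinitelyBetween nx y∈β q< ℓ
... | z , z∈β , x<z , z<y , z∉ℓ = z∉ℓ (finite z z∈β (inj₁ (x<z , z<y)))

FinEq-sym : ∀ {β x y} → FinEq β x y → FinEq β y x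
FinEq-sym (ℓ , finite) = ℓ , λ z z∈β → finite z z∈β ∘ swap

FinEq⇒sameQuot : ∀ β {x y} → Elem β x → Elem β y → FinEq β x y → quot x ≡ quot y
FinEq⇒sameQuot β {x} {y} x∈β y∈β fin with <ᴼ-cmp (quot x) (quot y)
... | tri< q< _ _ = ⊥-elim (quot<⇒¬FinEq x∈β y∈β q< fin)
... | tri≈ _ q≡ _ = q≡
... | tri> _ _ q> = ⊥-elim (quot<⇒¬FinEq y∈β x∈β q> (FinEq-sym fin))

quot-mono : ∀ {x y} → Normal y → x <ᴼ y → quot x ≤ᴼ quot y
quot-mono ny x<y = map₂ proj₁ (<ᴼ⇒<÷ ny x<y)

quot-condenses : ∀ {α} → Normal α → Condenses (ω· α + 0) α
quot-condenses {α} nα = quot , into , onto , classes , λ _ _ _ (ny , _) → quot-mono ny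
  where
  β = ω· α + 0
  into : ∀ x → Elem β x → Elem α (quot x)
  into x (nx , x<β) with <ᴼ⇒<÷ (ω·+-normal 0 nα) x<β
  ... | inj₁ q<      = quot-normal nx , subst (quot x <ᴼ_) (quot-ω·+ α 0) q<
  ... | inj₂ (_ , r<) = ⊥-elim (n≮0 (subst (rem x <_) (rem-ω·+ α 0) r<))
  onto : ∀ y → Elem α y → ∃ λ x → Elem β x × quot x ≡ y
  onto y (ny , y<α) = ω· y + 0 , (ω·+-normal 0 ny , y0<β) , quot-ω·+ y 0
    where
    y0<β : ω· y + 0 <ᴼ β
    y0<β = <÷⇒<ᴼ (inj₁ (subst₂ _<ᴼ_ (sym (quot-ω·+ y 0)) (sym (quot-ω·+ α 0)) y<α))
  classes : ∀ x y → Elem β x → Elem β y → FinEq β x y ⇔ (quot x ≡ quot y)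
  classes x y ex ey = mk⇔ (FinEq⇒sameQuot β ex ey) (sameQuot⇒FinEq β ex ey)

condensations-agree : ∀ {β α α′} (C : Condenses β α) (C′ : Condenses β α′) {x y} →
                      Elem β x → Elem β y → proj₁ C x <ᴼ proj₁ C y → proj₁ C′ x <ᴼ proj₁ C′ y
condensations-agree (f , _ , _ , f-classes , f-mono) (g , _ , _ , g-classes , g-mono) {x} {y} ex ey fx<fy
  with <ᴼ-cmp x y
... | tri≈ _ refl _ = ⊥-elim (<ᴼ-irrefl fx<fy)
... | tri> _ _ y<x  = ⊥-elim (≤ᴼ⇒≯ (f-mono y x ey ex y<x) fx<fy)
... | tri< x<y _ _ with g-mono x y ex ey x<y
...   | inj₁ gx<gy = gx<gy
...   | inj₂ gx≡gy = ⊥-elim (<ᴼ-irrefl (subst (_<ᴼ f y) fx≡fy fx<fy))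
  where
  fx≡fy : f x ≡ f y
  fx≡fy = Equivalence.to (f-classes x y ex ey) (Equivalence.from (g-classes x y ex ey) gx≡gy)

Increasing : (α : CNF) → (∀ γ → Elem α γ → CNF) → Set
Increasing α h = ∀ {γ δ} (e : Elem α γ) (e′ : Elem α δ) → γ <ᴼ δ → h γ e <ᴼ h δ e′

increasing⇒inflationary : ∀ {α} (h : ∀ γ → Elem α γ → CNF) → (∀ γ e → Elem α (h γ e)) →
                          Increasing α h → ∀ γ (e : Elem α γ) → ¬ h γ e <ᴼ γ
increasing⇒inflationary {α} h into increasing γ = go γ (<ᴼ-wellFounded γ)
  where
  go : ∀ γ → Acc _<ᴼ_ γ → (e : Elem α γ) → ¬ h γ e <ᴼ γ
  go γ (acc rs) e hγ<γ = go (h γ e) (rs hγ<γ) (into γ e) (increasing (into γ e) e hγ<γ)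

condensations-embed : ∀ {β α α′} → Condenses β α → Condenses β α′ →
                      Σ (∀ γ → Elem α γ → CNF) λ h → (∀ γ e → Elem α′ (h γ e)) × Increasing α h
condensations-embed C@(f , _ , f-onto , _) C′@(g , g-into , _) = h , into , increasing
  where
  h : ∀ γ → Elem _ γ → CNF
  h γ e = g (proj₁ (f-onto γ e))
  into : ∀ γ e → Elem _ (h γ e)
  into γ e = g-into _ (proj₁ (proj₂ (f-onto γ e)))
  increasing : Increasing _ h
  increasing {γ} {δ} e e′ γ<δ with f-onto γ e | f-onto δ e′
  ... | x , x∈β , refl | y , y∈β , refl = condensations-agree C C′ x∈β y∈β γ<δ

condensations-≮ : ∀ {β α α′} → Normal α′ → Condenses β α → Condenses β α′ → ¬ α′ <ᴼ α
condensations-≮ {α′ = α′} nα′ C C′ α′<α with condensations-embed C C′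
... | h , into , increasing =
  increasing⇒inflationary h (λ γ e → shrink (into γ e)) increasing α′ α′∈α (proj₂ (into α′ α′∈α))
  where
  shrink : ∀ {γ} → Elem α′ γ → Elem _ γ
  shrink (nγ , γ<α′) = nγ , <ᴼ-trans γ<α′ α′<α
  α′∈α : Elem _ α′
  α′∈α = nα′ , α′<α

condensation-unique : ∀ {β α α′} → Normal α → Normal α′ → Condenses β α → Condenses β α′ → α ≡ α′
condensation-unique {α = α} {α′} nα nα′ C C′ with <ᴼ-cmp α α′
... | tri< α<α′ _ _ = ⊥-elim (condensations-≮ nα C′ C α<α′)
... | tri≈ _ α≡α′ _ = α≡α′
... | tri> _ _ α′<α = ⊥-elim (condensations-≮ nα′ C C′ α′<α)

Greatest : CNF → CNF → Set
Greatest β M = Elem β M × (∀ x → Elem β x → x ≤ᴼ M)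

ω·+suc-greatest : ∀ {p} m → Normal p → Greatest (ω· p + suc m) (ω· p + m)
ω·+suc-greatest {p} m np = (nM , M<β) , M-max
  where
  M = ω· p + m
  nM = ω·+-normal m np
  quotM≡quotβ : quot M ≡ quot (ω· p + suc m)
  quotM≡quotβ = trans (quot-ω·+ p m) (sym (quot-ω·+ p (suc m)))
  M<β : M <ᴼ ω· p + suc m
  M<β = <÷⇒<ᴼ (inj₂ (quotM≡quotβ , subst₂ _<_ (sym (rem-ω·+ p m)) (sym (rem-ω·+ p (suc m))) ≤-refl))
  M-max : ∀ x → Elem (ω· p + suc m) x → x ≤ᴼ M
  M-max x (nx , x<β) with <ᴼ-cmp x M
  ... | tri< x<M _ _ = inj₁ x<M
  ... | tri≈ _ x≡M _ = inj₂ x≡M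
  ... | tri> _ _ M<x with <÷-sandwich quotM≡quotβ (<ᴼ⇒<÷ nx M<x) (<ᴼ⇒<÷ (ω·+-normal (suc m) np) x<β)
  ...   | _ , m<r , r<1+m = ⊥-elim (≤⇒≯ (≤-pred (subst (rem x <_) (rem-ω·+ p (suc m)) r<1+m))
                                         (subst (_< rem x) (rem-ω·+ p m) m<r))

condensation-greatest : ∀ {β α M} (C : Condenses β α) → Greatest β M → Greatest α (proj₁ C M)
condensation-greatest {M = M} (f , f-into , f-onto , _ , f-mono) (M∈β , M-max) = f-into M M∈β , below
  where
  below : ∀ y → Elem _ y → y ≤ᴼ f M
  below y y∈α with f-onto y y∈α
  ... | x , x∈β , refl with M-max x x∈β
  ...   | inj₁ x<M  = f-mono x M x∈β M∈β x<M
  ...   | inj₂ refl = inj₂ refl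

limit-¬greatest : ∀ {α γ} → Limit α → ¬ Greatest α γ
limit-¬greatest (_ , unbounded) (γ∈α , γ-max) with unbounded _ γ∈α
... | δ , δ∈α , γ<δ = ≤ᴼ⇒≯ (γ-max δ δ∈α) γ<δ

ω·+suc-¬condenses-limit : ∀ {α p} m → Limit α → Normal p → ¬ Condenses (ω· p + suc m) α
ω·+suc-¬condenses-limit m lim np C = limit-¬greatest lim (condensation-greatest C (ω·+suc-greatest m np))

condenses-onto-limit : ∀ {α β} → Normal α → Limit α → Normal β → Condenses β α → β ≡ ω· α + 0
condenses-onto-limit {α} {β} nα lim nβ C with rem β | ω·quot+rem nβ
... | zero  | β≡ = trans (sym β≡) (cong (λ q → ω· q + 0) (condensation-unique (quot-normal nβ) nα C₀ C))
  where
  C₀ : Condenses β (quot β)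
  C₀ = subst (λ b → Condenses b (quot β)) β≡ (quot-condenses (quot-normal nβ))
... | suc m | β≡ = ⊥-elim (ω·+suc-¬condenses-limit m lim (quot-normal nβ) (subst (λ b → Condenses b α) (sym β≡) C))

mainTheorem7 :
    (∀ β α α′ → Normal β → Normal α → Normal α′ →
       Condenses β α → Condenses β α′ → α ≡ α′)
    ×
    (∀ α → Normal α → Limit α →
       ∃ λ β → Normal β × Condenses β α ×
         (∀ β′ → Normal β′ → Condenses β′ α → β′ ≡ β))
mainTheorem7 =
    (λ _ _ _ _ nα nα′ → condensation-unique nα nα′)
  , λ α nα lim → ω· α + 0 , ω·+-normal 0 nα , quot-condenses nα , λ _ nβ′ → condenses-onto-limit nα lim nβ′
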